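{- Let $r,k$ be coprime with $1\le k<r/3$ and $\{0,k\}\subseteq A\subseteq[0,k]\subseteq\mathbb{Z}/r\mathbb{Z}$. Let $J_+,J_-\subseteq\mathbb{Z}/r\mathbb{Z}$ and $u\in\mathbb{Z}/r\mathbb{Z}\setminus(J_+\cup J_-)$, and suppose $\Gamma_0=\{P_w\}_{w\in J_+}\cup\{\lnot P_{w_0}\}_{w_0\in J_- }$ is consistent. Then $\Gamma_0\sqcup\{P_u\}$ is inconsistent if and only if there exists $w_0\in J_-$ with $(A+w_0)\cap(A+u)\neq\varnothing$ such that $A+w_0\subseteq\bigcup_{w\in J_+\cup\{u\}}(A+w)$.
   Context: $[a,b]=\{\overline a,\dots,\overline b\}\subseteq\mathbb{Z}/r\mathbb{Z}$ for integers $a\le b$; $A+w=\{a+w\mid a\in A\}$. For a valuation $V\subseteq\mathbb{Z}/r\mathbb{Z}$, $P_w$ is true iff $A+w\subseteq V$, and $\lnot P_w$ is its negation. A set of such propositions is consistent if some valuation $V\subseteq\mathbb{Z}/r\mathbb{Z}$ makes all of them true. -}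

module Defs where

open import Level using (0ℓ)
open import Data.Nat using (ℕ; _+_; _≤_; NonZero)
open import Data.Nat.DivMod using (_mod_)
open import Data.Fin using (Fin; toℕ)
open import Data.Fin.Subset using (Subset; _∈_)
open import Data.Product using (Σ; ∃; _×_)
open import Data.Sum using (_⊎_)
open import Relation.Nullary using (¬_)
open import Relation.Binary.PropositionalEquality using (_≡_)

-- ℤ/rℤ is modelled as Fin r, with residue i represented by i mod r.
-- Addition in ℤ/rℤ.
_+ᵣ_ : ∀ {r} .{{_ : NonZero r}} → Fin r → Fin r → Fin r
_+ᵣ_ {r} a b = (toℕ a + toℕ b) mod r

[_]ᵣ : ∀ {r} .{{_ : NonZero r}} → ℕ → Fin r
[_]ᵣ {r} i = i mod r

_∈[0,_] : ∀ {r} .{{_ : NonZero r}} → Fin r → ℕ → Set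
_∈[0,_] {r} x b = ∃ λ i → i ≤ b × [ i ]ᵣ ≡ x

_∈_⊕_ : ∀ {r} .{{_ : NonZero r}} → Fin r → Subset r → Fin r → Set
x ∈ A ⊕ w = ∃ λ a → a ∈ A × x ≡ a +ᵣ w

-- The proposition P_w under valuation V: A + w ⊆ V.
P : ∀ {r} .{{_ : NonZero r}} → Subset r → Fin r → Subset r → Set
P A w V = ∀ x → x ∈ A ⊕ w → x ∈ V

Γ₀-holds : ∀ {r} .{{_ : NonZero r}} → Subset r → Subset r → Subset r → Subset r → Set
Γ₀-holds A J₊ J₋ V = (∀ w → w ∈ J₊ → P A w V) × (∀ w₀ → w₀ ∈ J₋ → ¬ P A w₀ V)

Γ₀-consistent : ∀ {r} .{{_ : NonZero r}} → Subset r → Subset r → Subset r → Set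
Γ₀-consistent {r} A J₊ J₋ = Σ (Subset r) λ V → Γ₀-holds A J₊ J₋ V

Γ₀+Pu-consistent : ∀ {r} .{{_ : NonZero r}} → Subset r → Subset r → Subset r → Fin r → Set
Γ₀+Pu-consistent {r} A J₊ J₋ u = Σ (Subset r) λ V → Γ₀-holds A J₊ J₋ V × P A u V

-- The valuations satisfying P_w for all w ∈ J₊ ∪ {u} are exactly the supersets of
-- U = ⋃_{w ∈ J₊ ∪ {u}} (A + w), since P_w only asks A + w ⊆ V. So Γ₀ ⊔ {P_u} is
-- consistent iff U itself satisfies every ¬P_{w₀}, i.e. iff no A + w₀ with w₀ ∈ J₋ is
-- covered by U. If A + w₀ is covered, take a valuation V of Γ₀: some point of A + w₀
-- lies outside V ⊇ ⋃_{w ∈ J₊} (A + w), so the translate covering it is A + u.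
module Submission where

open import Defs
open import Level using (0ℓ)
open import Data.Nat using (ℕ; _*_; _≤_; _<_; NonZero)
open import Data.Nat.Coprimality using (Coprime)
open import Data.Fin using (Fin)
open import Data.Fin.Subset using (Subset; _∈_; _∉_)
open import Data.Fin.Subset.Properties using (_∈?_)
import Data.Fin.Properties as Fin
open import Data.Vec using (tabulate)
open import Data.Vec.Properties using (lookup∘tabulate; lookup⇒[]=; []=⇒lookup)
open import Data.Product using (∃; _×_; _,_)
open import Data.Sum using (_⊎_; inj₁; inj₂)
open import Data.Empty using (⊥-elim)
open import Function using (_∘_)
open import Function.Bundles using (_⇔_; mk⇔)
open import Relation.Nullary using (¬_; Dec; yes; no; does; _×-dec_; _⊎-dec_; _→-dec_; ¬?; contradiction)
open import Relation.Nullary.Decidable using (dec-true; decidable-stable)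
open import Relation.Unary using (Pred; Decidable)
open import Relation.Binary.PropositionalEquality using (_≡_; refl; sym; trans)

module _ {r : ℕ} {Q : Pred (Fin r) 0ℓ} (Q? : Decidable Q) where

  toSubset : Subset r
  toSubset = tabulate (does ∘ Q?)

  ∈toSubset⁺ : ∀ {x} → Q x → x ∈ toSubset
  ∈toSubset⁺ {x} q = lookup⇒[]= x toSubset (trans (lookup∘tabulate _ x) (dec-true (Q? x) q))

  ∈toSubset⁻ : ∀ {x} → x ∈ toSubset → Q x
  ∈toSubset⁻ {x} x∈ with Q? x | trans (sym (lookup∘tabulate _ x)) ([]=⇒lookup x∈)
  ... | yes q | _  = q
  ... | no _  | ()

module _ {r : ℕ} .{{_ : NonZero r}} (A : Subset r) where

  ∈⊕? : ∀ x w → Dec (x ∈ A ⊕ w)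
  ∈⊕? x w = Fin.any? (λ a → (a ∈? A) ×-dec (x Fin.≟ a +ᵣ w))

  P? : ∀ w V → Dec (P A w V)
  P? w V = Fin.all? (λ x → ∈⊕? x w →-dec (x ∈? V))

  ¬P⇒∃∉ : ∀ {w V} → ¬ P A w V → ∃ λ x → x ∈ A ⊕ w × x ∉ V
  ¬P⇒∃∉ {w} {V} ¬p with Fin.any? (λ x → ∈⊕? x w ×-dec ¬? (x ∈? V))
  ... | yes witness = witness
  ... | no  none    = contradiction (λ x x∈ → decidable-stable (x ∈? V) (λ x∉ → none (x , x∈ , x∉))) ¬p

  module _ (J₊ : Subset r) (u : Fin r) where

    Covered : Fin r → Set
    Covered x = ∃ λ w → (w ∈ J₊ ⊎ w ≡ u) × x ∈ A ⊕ w

    Covered? : Decidable Covered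
    Covered? x = Fin.any? (λ w → ((w ∈? J₊) ⊎-dec (w Fin.≟ u)) ×-dec ∈⊕? x w)

    ⋃⊕ : Subset r
    ⋃⊕ = toSubset Covered?

    P-⋃⊕ : ∀ w → w ∈ J₊ ⊎ w ≡ u → P A w ⋃⊕
    P-⋃⊕ w w∈ x x∈ = ∈toSubset⁺ Covered? (w , w∈ , x∈)

    ⋃⊕-consistent : ∀ J₋ → (∀ w₀ → w₀ ∈ J₋ → ¬ P A w₀ ⋃⊕) → Γ₀+Pu-consistent A J₊ J₋ u
    ⋃⊕-consistent J₋ ¬p₋ = ⋃⊕ , ((λ w w∈ → P-⋃⊕ w (inj₁ w∈)) , ¬p₋) , P-⋃⊕ u (inj₂ refl)

    covered⇒∈ : ∀ {V} → (∀ w → w ∈ J₊ → P A w V) → P A u V → ∀ {x} → Covered x → x ∈ V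
    covered⇒∈ p₊ pᵤ (w , inj₁ w∈ , x∈)  = p₊ w w∈ _ x∈
    covered⇒∈ p₊ pᵤ (w , inj₂ refl , x∈) = pᵤ _ x∈

    covered-∉⇒∈A+u : ∀ {V} → (∀ w → w ∈ J₊ → P A w V) → ∀ {x} → x ∉ V → Covered x → x ∈ A ⊕ u
    covered-∉⇒∈A+u p₊ x∉ (w , inj₁ w∈ , x∈)  = ⊥-elim (x∉ (p₊ w w∈ _ x∈))
    covered-∉⇒∈A+u p₊ x∉ (w , inj₂ refl , x∈) = x∈

lemma3 : (r k : ℕ) .{{_ : NonZero r}} → Coprime r k → 1 ≤ k → 3 * k < r →
    (A : Subset r) → [ 0 ]ᵣ ∈ A → [ k ]ᵣ ∈ A → (∀ x → x ∈ A → x ∈[0, k ]) →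
    (J₊ J₋ : Subset r) (u : Fin r) → u ∉ J₊ → u ∉ J₋ →
    Γ₀-consistent A J₊ J₋ →
    (¬ Γ₀+Pu-consistent A J₊ J₋ u)
    ⇔ (∃ λ w₀ → w₀ ∈ J₋
    × (∃ λ x → x ∈ A ⊕ w₀ × x ∈ A ⊕ u)
    × (∀ x → x ∈ A ⊕ w₀ → ∃ λ w → (w ∈ J₊ ⊎ w ≡ u) × x ∈ A ⊕ w))
lemma3 r k _ _ _ A _ _ _ J₊ J₋ u _ _ (_ , p₊ , ¬p₋) = mk⇔ inconsistent⇒covered covered⇒inconsistent
  where
  U : Subset r
  U = ⋃⊕ A J₊ u

  Covering : Set
  Covering = ∃ λ w₀ → w₀ ∈ J₋ × (∃ λ x → x ∈ A ⊕ w₀ × x ∈ A ⊕ u)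
                     × (∀ x → x ∈ A ⊕ w₀ → Covered A J₊ u x)

  inconsistent⇒covered : ¬ Γ₀+Pu-consistent A J₊ J₋ u → Covering
  inconsistent⇒covered incons with Fin.any? (λ w₀ → (w₀ ∈? J₋) ×-dec P? A w₀ U)
  ... | yes (w₀ , w₀∈ , pU) =
    let (x , x∈ , x∉) = ¬P⇒∃∉ A (¬p₋ w₀ w₀∈)
        covered = λ y y∈ → ∈toSubset⁻ (Covered? A J₊ u) (pU y y∈)
    in  w₀ , w₀∈ , (x , x∈ , covered-∉⇒∈A+u A J₊ u p₊ x∉ (covered x x∈)) , covered
  ... | no none = ⊥-elim (incons (⋃⊕-consistent A J₊ u J₋ λ w₀ w₀∈ pU → none (w₀ , w₀∈ , pU)))

  covered⇒inconsistent : Covering → ¬ Γ₀+Pu-consistent A J₊ J₋ u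
  covered⇒inconsistent (w₀ , w₀∈ , _ , covered) (V , (q₊ , ¬q₋) , qᵤ) =
    ¬q₋ w₀ w₀∈ (λ x x∈ → covered⇒∈ A J₊ u q₊ qᵤ (covered x x∈))
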